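{- For integers $n,k\geq 1$ and $\lambda\in\mathbb{C}$, $$G_{k}^{(n+1)}(\lambda)=2kG_{k-1}^{(n)}(\lambda)-\Big(2-\frac{2k}{n}\Big)G_{k}^{(n)}(\lambda).$$
   Context: Apostol-Genocchi numbers of order $n$: $\Big(\frac{2t}{\lambda e^{t}+1}\Big)^{n}=\sum_{k\ge0}G_{k}^{(n)}(\lambda)\frac{t^{k}}{k!}$. -}

module Defs where

open import Level using (Level; _⊔_) renaming (suc to lsuc)
open import Data.Nat using (ℕ; zero; suc; _≡ᵇ_; _!) renaming (_*_ to _*ℕ_; _^_ to _^ℕ_)
open import Data.Nat.Combinatorics using (_C_)
open import Data.Bool using (if_then_else_)
open import Data.Product using (∃)
open import Algebra.Bundles using (CommutativeRing)
open import Relation.Nullary using (¬_)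

-- A field of characteristic zero (the paper works over ℂ, which is one;
-- ℂ itself is not available in agda-stdlib).
-- embedding of ℕ into a ring : n ↦ 1 + 1 + ... + 1
natR : ∀ {c ℓ} (R : CommutativeRing c ℓ) → ℕ → CommutativeRing.Carrier R
natR R zero = CommutativeRing.0# R
natR R (suc n) = CommutativeRing._+_ R (CommutativeRing.1# R) (natR R n)

record CharZeroField (c ℓ : Level) : Set (lsuc (c ⊔ ℓ)) where
  field
    commRing : CommutativeRing c ℓ
  open CommutativeRing commRing public
  nat : ℕ → Carrier
  nat = natR commRing
  field
    0≉1       : ¬ (0# ≈ 1#)
    inverse   : ∀ x → ¬ (x ≈ 0#) → ∃ λ y → x * y ≈ 1#
    charZero  : ∀ n → ¬ (nat (suc n) ≈ 0#)

module ApostolGenocchi {c ℓ : Level} (F : CharZeroField c ℓ) where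
  open CharZeroField F using (Carrier; _≈_; _+_; _*_; 0#; 1#; nat)

  sumUpTo : (ℕ → Carrier) → ℕ → Carrier
  sumUpTo f zero = f zero
  sumUpTo f (suc k) = sumUpTo f k + f (suc k)

  -- A formal power series Σ a_k t^k / k! is represented by its sequence
  -- of (exponential) coefficients a : ℕ → Carrier.
  -- Product of exponential generating functions.
  egfMul : (ℕ → Carrier) → (ℕ → Carrier) → ℕ → Carrier
  egfMul a b k = sumUpTo (λ j → nat (k C j) * (a j * b (k Data.Nat.∸ j))) k

  egfOne : ℕ → Carrier
  egfOne zero = 1#
  egfOne (suc k) = 0#

  egfPow : (ℕ → Carrier) → ℕ → ℕ → Carrier
  egfPow a zero = egfOne
  egfPow a (suc n) = egfMul a (egfPow a n)

  -- λ e^t + 1 :  coefficients  λ + 1, λ, λ, ...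
  lamExpPlusOne : Carrier → ℕ → Carrier
  lamExpPlusOne l zero = l + 1#
  lamExpPlusOne l (suc k) = l

  -- (2t)^n = 2^n n! · t^n / n!
  twoTPow : ℕ → ℕ → Carrier
  twoTPow n k = if k ≡ᵇ n then nat ((2 ^ℕ n) *ℕ (n !)) else 0#

  -- G is the coefficient sequence of (2t/(λ e^t + 1))^n, i.e. the
  -- power series satisfying (λ e^t + 1)^n · G = (2t)^n.
  IsApostolGenocchi : Carrier → ℕ → (ℕ → Carrier) → Set ℓ
  IsApostolGenocchi l n G = ∀ k → egfMul (egfPow (lamExpPlusOne l) n) G k ≈ twoTPow n k

-- Work in the ring of exponential generating functions
-- (Hurwitz series), where d/dt is the shift ∂ of coefficients and
-- multiplication by t sends aₖ to k aₖ₋₁.  With H = λeᵗ + 1 and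
-- G = G⁽ⁿ⁾, the defining equation Hⁿ G = (2t)ⁿ, its derivative, the power
-- rule H ∂(Hⁿ) = n ∂H Hⁿ, the identities ∂H = H - 1 and t ∂(2t)ⁿ = n (2t)ⁿ
-- give, by pure ring algebra,
--   Hⁿ⁺¹ (2t G + (2/n) t ∂G - 2 G) = (2t)ⁿ⁺¹ = Hⁿ⁺¹ G⁽ⁿ⁺¹⁾.
-- Since H · G⁽¹⁾ = 2t is not a zero divisor (characteristic zero), Hⁿ⁺¹
-- can be cancelled, and comparing coefficients of tᵏ/k! is the theorem.
module Submission where

open import Defs
open import Level using (Level; _⊔_)
open import Algebra.Bundles using (CommutativeRing)
open import Algebra.Structures using (IsCommutativeRing)
open import Data.Nat as ℕ using (ℕ; zero; suc; _≤_; _∸_; _!; _^_; _≟_; s≤s; z≤n) renaming (_*_ to _*ℕ_)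
import Data.Nat.Properties as ℕ
open import Data.Nat.Combinatorics using (_C_; nCk+nC[k+1]≡[n+1]C[k+1]; k>n⇒nCk≡0)
open import Data.Nat.Tactic.RingSolver using (solve-∀)
open import Data.Integer as ℤ using (ℤ; +_; -[1+_])
import Data.Integer.Properties as ℤ
open import Data.Bool using (true; false; if_then_else_) renaming (T to IsTrue)
open import Data.Empty using (⊥-elim)
open import Data.Maybe using (Maybe; just; nothing)
open import Data.Product using (_,_; proj₂)
open import Data.Unit using (tt)
open import Function using (_∘_)
open import Relation.Binary.Structures using (IsEquivalence)
open import Relation.Nullary using (¬_; Dec; yes; no)
import Relation.Binary.PropositionalEquality as ≡
import Relation.Binary.Reasoning.Setoid

-- Integer coefficients are
-- needed so that normal forms cancel (x - x normalises to 0).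
module IntegerCoefficients {c ℓ} (R : CommutativeRing c ℓ) where
  open CommutativeRing R
  open import Relation.Binary.Reasoning.Setoid setoid
  open import Algebra.Properties.Semiring.Mult.TCOptimised semiring using (_×_; 1+×; ×-homo-+; ×1-homo-*)
  open import Algebra.Properties.AbelianGroup +-abelianGroup using (⁻¹-∙-comm)
  open import Algebra.Properties.Group +-group using (ε⁻¹≈ε; ⁻¹-involutive)
  open import Algebra.Properties.Ring ring using (-‿distribˡ-*; -‿distribʳ-*)
  open import Algebra.Solver.Ring.AlmostCommutativeRing
    using (fromCommutativeRing; _-Raw-AlmostCommutative⟶_)

  natR≈×1 : ∀ n → natR R n ≈ n × 1#
  natR≈×1 zero    = refl
  natR≈×1 (suc n) = trans (+-congˡ (natR≈×1 n)) (sym (1+× n 1#))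

  natR-+ : ∀ m n → natR R (m ℕ.+ n) ≈ natR R m + natR R n
  natR-+ m n = begin
    natR R (m ℕ.+ n)      ≈⟨ natR≈×1 (m ℕ.+ n) ⟩
    (m ℕ.+ n) × 1#        ≈⟨ ×-homo-+ 1# m n ⟩
    m × 1# + n × 1#       ≈⟨ +-cong (natR≈×1 m) (natR≈×1 n) ⟨
    natR R m + natR R n   ∎

  natR-* : ∀ m n → natR R (m ℕ.* n) ≈ natR R m * natR R n
  natR-* m n = begin
    natR R (m ℕ.* n)      ≈⟨ natR≈×1 (m ℕ.* n) ⟩
    (m ℕ.* n) × 1#        ≈⟨ ×1-homo-* m n ⟩
    (m × 1#) * (n × 1#)   ≈⟨ *-cong (natR≈×1 m) (natR≈×1 n) ⟨
    natR R m * natR R n   ∎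

  ⟦_⟧ℤ : ℤ → Carrier
  ⟦ + n ⟧ℤ      = n × 1#
  ⟦ -[1+ n ] ⟧ℤ = - (suc n × 1#)

  ⟦-⟧ℤ-homo : ∀ i → ⟦ ℤ.- i ⟧ℤ ≈ - ⟦ i ⟧ℤ
  ⟦-⟧ℤ-homo -[1+ n ]    = sym (⁻¹-involutive _)
  ⟦-⟧ℤ-homo (+ zero)    = sym ε⁻¹≈ε
  ⟦-⟧ℤ-homo (+ suc n)   = refl

  ⟦⊖⟧ℤ : ∀ m n → ⟦ m ℤ.⊖ n ⟧ℤ ≈ m × 1# - n × 1#
  ⟦⊖⟧ℤ zero    zero    = sym (trans (+-congˡ ε⁻¹≈ε) (+-identityʳ 0#))
  ⟦⊖⟧ℤ zero    (suc n) = sym (+-identityˡ _)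
  ⟦⊖⟧ℤ (suc m) zero    = sym (trans (+-congˡ ε⁻¹≈ε) (+-identityʳ _))
  ⟦⊖⟧ℤ (suc m) (suc n) = begin
    ⟦ suc m ℤ.⊖ suc n ⟧ℤ                ≡⟨ ≡.cong ⟦_⟧ℤ (ℤ.[1+m]⊖[1+n]≡m⊖n m n) ⟩
    ⟦ m ℤ.⊖ n ⟧ℤ                        ≈⟨ ⟦⊖⟧ℤ m n ⟩
    M - N                               ≈⟨ +-congʳ (+-identityˡ _) ⟨
    (0# + M) - N                        ≈⟨ +-congʳ (+-congʳ (-‿inverseʳ 1#)) ⟨
    ((1# - 1#) + M) - N                 ≈⟨ +-congʳ (+-assoc _ _ _) ⟩
    (1# + (- 1# + M)) - N               ≈⟨ +-congʳ (+-congˡ (+-comm _ _)) ⟩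
    (1# + (M - 1#)) - N                 ≈⟨ +-congʳ (+-assoc _ _ _) ⟨
    ((1# + M) - 1#) - N                 ≈⟨ +-assoc _ _ _ ⟩
    (1# + M) + (- 1# - N)               ≈⟨ +-congˡ (⁻¹-∙-comm _ _) ⟩
    (1# + M) - (1# + N)                 ≈⟨ +-cong (1+× m 1#) (-‿cong (1+× n 1#)) ⟨
    suc m × 1# - suc n × 1#             ∎
    where M = m × 1#; N = n × 1#

  ⟦+⟧ℤ-homo : ∀ i j → ⟦ i ℤ.+ j ⟧ℤ ≈ ⟦ i ⟧ℤ + ⟦ j ⟧ℤ
  ⟦+⟧ℤ-homo -[1+ m ] -[1+ n ] = begin
    - (suc (suc (m ℕ.+ n)) × 1#)        ≡⟨ ≡.cong (λ z → - (suc z × 1#)) (ℕ.+-suc m n) ⟨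
    - ((suc m ℕ.+ suc n) × 1#)          ≈⟨ -‿cong (×-homo-+ 1# (suc m) (suc n)) ⟩
    - (suc m × 1# + suc n × 1#)         ≈⟨ ⁻¹-∙-comm _ _ ⟨
    - (suc m × 1#) - (suc n × 1#)       ∎
  ⟦+⟧ℤ-homo -[1+ m ] (+ n)    = trans (⟦⊖⟧ℤ n (suc m)) (+-comm _ _)
  ⟦+⟧ℤ-homo (+ m)    -[1+ n ] = ⟦⊖⟧ℤ m (suc n)
  ⟦+⟧ℤ-homo (+ m)    (+ n)    = ×-homo-+ 1# m n

  private
    ⟦*⟧ℤ-homo-+ : ∀ m j → ⟦ + m ℤ.* j ⟧ℤ ≈ m × 1# * ⟦ j ⟧ℤ
    ⟦*⟧ℤ-homo-+ m (+ n) = begin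
      ⟦ + m ℤ.* + n ⟧ℤ      ≡⟨ ≡.cong ⟦_⟧ℤ (ℤ.pos-* m n) ⟨
      (m ℕ.* n) × 1#        ≈⟨ ×1-homo-* m n ⟩
      m × 1# * n × 1#       ∎
    ⟦*⟧ℤ-homo-+ m -[1+ n ] = begin
      ⟦ + m ℤ.* -[1+ n ] ⟧ℤ           ≡⟨ ≡.cong ⟦_⟧ℤ (ℤ.neg-distribʳ-* (+ m) (+ suc n)) ⟨
      ⟦ ℤ.- (+ m ℤ.* + suc n) ⟧ℤ      ≈⟨ ⟦-⟧ℤ-homo (+ m ℤ.* + suc n) ⟩
      - ⟦ + m ℤ.* + suc n ⟧ℤ          ≈⟨ -‿cong (⟦*⟧ℤ-homo-+ m (+ suc n)) ⟩
      - (m × 1# * suc n × 1#)         ≈⟨ -‿distribʳ-* _ _ ⟩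
      m × 1# * - (suc n × 1#)         ∎

  ⟦*⟧ℤ-homo : ∀ i j → ⟦ i ℤ.* j ⟧ℤ ≈ ⟦ i ⟧ℤ * ⟦ j ⟧ℤ
  ⟦*⟧ℤ-homo (+ m)    j = ⟦*⟧ℤ-homo-+ m j
  ⟦*⟧ℤ-homo -[1+ m ] j = begin
    ⟦ -[1+ m ] ℤ.* j ⟧ℤ            ≡⟨ ≡.cong ⟦_⟧ℤ (ℤ.neg-distribˡ-* (+ suc m) j) ⟨
    ⟦ ℤ.- (+ suc m ℤ.* j) ⟧ℤ       ≈⟨ ⟦-⟧ℤ-homo (+ suc m ℤ.* j) ⟩
    - ⟦ + suc m ℤ.* j ⟧ℤ           ≈⟨ -‿cong (⟦*⟧ℤ-homo-+ (suc m) j) ⟩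
    - (suc m × 1# * ⟦ j ⟧ℤ)        ≈⟨ -‿distribˡ-* _ _ ⟩
    - (suc m × 1#) * ⟦ j ⟧ℤ        ∎

  ℤ⟶R : ℤ.+-*-rawRing -Raw-AlmostCommutative⟶ fromCommutativeRing R
  ℤ⟶R = record
    { ⟦_⟧    = ⟦_⟧ℤ
    ; +-homo = ⟦+⟧ℤ-homo
    ; *-homo = ⟦*⟧ℤ-homo
    ; -‿homo = ⟦-⟧ℤ-homo
    ; 0-homo = refl
    ; 1-homo = refl
    }

  -- The solver only needs to recognise syntactically equal coefficients.
  ℤ-coefficient-equality : ∀ i j → Maybe (⟦ i ⟧ℤ ≈ ⟦ j ⟧ℤ)
  ℤ-coefficient-equality i j with i ℤ.≟ j
  ... | yes ≡.refl = just refl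
  ... | no _     = nothing

  open import Algebra.Solver.Ring ℤ.+-*-rawRing (fromCommutativeRing R) ℤ⟶R ℤ-coefficient-equality public

module CommutativeRingFacts {c ℓ} (R : CommutativeRing c ℓ) where
  open CommutativeRing R
  open import Relation.Binary.Reasoning.Setoid setoid
  open import Algebra.Properties.Group +-group using (x∙y⁻¹≈ε⇒x≈y)
  open import Algebra.Properties.Ring ring using (x[y-z]≈xy-xz)
  open IntegerCoefficients R using (solve; _:+_; _:*_; _:-_; _:=_; con)

  Cancellable : Carrier → Set (c ⊔ ℓ)
  Cancellable a = ∀ y → a * y ≈ 0# → y ≈ 0#

  cancel : ∀ {a x y} → Cancellable a → a * x ≈ a * y → x ≈ y
  cancel {a} {x} {y} cancellable ax≈ay = x∙y⁻¹≈ε⇒x≈y x y (cancellable (x - y) (begin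
    a * (x - y)     ≈⟨ x[y-z]≈xy-xz a x y ⟩
    a * x - a * y   ≈⟨ +-congʳ ax≈ay ⟩
    a * y - a * y   ≈⟨ -‿inverseʳ (a * y) ⟩
    0#              ∎))

  cancellable-unit : ∀ {a b} → a * b ≈ 1# → Cancellable a
  cancellable-unit {a} {b} ab≈1 y ay≈0 = begin
    y             ≈⟨ *-identityˡ y ⟨
    1# * y        ≈⟨ *-congʳ ab≈1 ⟨
    (a * b) * y   ≈⟨ *-congʳ (*-comm a b) ⟩
    (b * a) * y   ≈⟨ *-assoc b a y ⟩
    b * (a * y)   ≈⟨ *-congˡ ay≈0 ⟩
    b * 0#        ≈⟨ zeroʳ b ⟩
    0#            ∎

  cancellable-* : ∀ {a b} → Cancellable a → Cancellable b → Cancellable (a * b)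
  cancellable-* {a} {b} cancellable-a cancellable-b y aby≈0 =
    cancellable-b y (cancellable-a (b * y) (trans (sym (*-assoc a b y)) aby≈0))

  cancellable-divisor : ∀ {a b d} → a * b ≈ d → Cancellable d → Cancellable a
  cancellable-divisor {a} {b} {d} ab≈d cancellable-d y ay≈0 = cancellable-d y (begin
    d * y         ≈⟨ *-congʳ ab≈d ⟨
    (a * b) * y   ≈⟨ *-congʳ (*-comm a b) ⟩
    (b * a) * y   ≈⟨ *-assoc b a y ⟩
    b * (a * y)   ≈⟨ *-congˡ ay≈0 ⟩
    b * 0#        ≈⟨ zeroʳ b ⟩
    0#            ∎)

  cancellable-resp : ∀ {a b} → a ≈ b → Cancellable a → Cancellable b
  cancellable-resp {a} {b} a≈b = cancellable-divisor (trans (*-identityʳ b) (sym a≈b))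

  -- Inductive step of the power rule ∂(Aᵐ) = m Aᵐ⁻¹ ∂A, in the form
  -- A ∂Q = m ∂A Q  ⟹  A ∂(A Q) = (1 + m) ∂A (A Q), where ∂(A Q) = ∂A Q + A ∂Q.
  power-rule-step : ∀ {A ∂A Q ∂Q m} → A * ∂Q ≈ m * (∂A * Q) →
    A * (∂A * Q + A * ∂Q) ≈ (1# + m) * (∂A * (A * Q))
  power-rule-step {A} {∂A} {Q} {∂Q} {m} A∂Q≈m∂AQ = begin
    A * (∂A * Q + A * ∂Q)         ≈⟨ *-congˡ (+-congˡ A∂Q≈m∂AQ) ⟩
    A * (∂A * Q + m * (∂A * Q))   ≈⟨ solve 4 (λ A ∂A Q m →
                                       A :* (∂A :* Q :+ m :* (∂A :* Q)) :=
                                       (con (+ 1) :+ m) :* (∂A :* (A :* Q))) refl A ∂A Q m ⟩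
    (1# + m) * (∂A * (A * Q))        ∎

  -- The algebraic heart of the recurrence.  Read H = λeᵗ + 1, P = Hⁿ,
  -- T = (2t)ⁿ, G = T/P, T′ = (2t)ⁿ⁺¹, and ∂X for the derivative of X.
  -- First: H P · t ∂G = n (H T - t ∂H T).
  derivative-term : ∀ {H ∂H P ∂P G ∂G T ∂T t n} →
    P * G ≈ T → ∂P * G + P * ∂G ≈ ∂T → H * ∂P ≈ n * (∂H * P) → t * ∂T ≈ n * T →
    (H * P) * (t * ∂G) ≈ n * (H * T - t * (∂H * T))
  derivative-term {H} {∂H} {P} {∂P} {G} {∂G} {T} {∂T} {t} {n} PG≈T ∂[PG]≈∂T H∂P≈n∂HP t∂T≈nT = begin
    (H * P) * (t * ∂G)
      ≈⟨ solve 7 (λ H P ∂P G ∂G t n →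
           (H :* P) :* (t :* ∂G) := H :* (t :* (∂P :* G :+ P :* ∂G)) :- (t :* G) :* (H :* ∂P))
           refl H P ∂P G ∂G t n ⟩
    H * (t * (∂P * G + P * ∂G)) - (t * G) * (H * ∂P)
      ≈⟨ +-cong (*-congˡ (*-congˡ ∂[PG]≈∂T)) (-‿cong (*-congˡ H∂P≈n∂HP)) ⟩
    H * (t * ∂T) - (t * G) * (n * (∂H * P))
      ≈⟨ +-congʳ (*-congˡ t∂T≈nT) ⟩
    H * (n * T) - (t * G) * (n * (∂H * P))
      ≈⟨ solve 7 (λ H ∂H P G T t n →
           H :* (n :* T) :- (t :* G) :* (n :* (∂H :* P)) := n :* (H :* T :- t :* (∂H :* (P :* G))))
           refl H ∂H P G T t n ⟩
    n * (H * T - t * (∂H * (P * G)))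
      ≈⟨ *-congˡ (+-congˡ (-‿cong (*-congˡ (*-congˡ PG≈T)))) ⟩
    n * (H * T - t * (∂H * T)) ∎

  recurrence-identity : ∀ {H ∂H P ∂P G ∂G T ∂T T′ t n n⁻¹ two} →
    P * G ≈ T → ∂P * G + P * ∂G ≈ ∂T → H * ∂P ≈ n * (∂H * P) → t * ∂T ≈ n * T →
    ∂H ≈ H - 1# → n * n⁻¹ ≈ 1# → two * (t * T) ≈ T′ →
    (H * P) * (two * (t * G) + (two * n⁻¹) * (t * ∂G) - two * G) ≈ T′
  recurrence-identity {H} {∂H} {P} {∂P} {G} {∂G} {T} {∂T} {T′} {t} {n} {n⁻¹} {two}
                      PG≈T ∂[PG]≈∂T H∂P≈n∂HP t∂T≈nT ∂H≈H-1 nn⁻¹≈1 2tT≈T′ = begin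
    (H * P) * (two * (t * G) + (two * n⁻¹) * (t * ∂G) - two * G)
      ≈⟨ solve 7 (λ H P G ∂G t n⁻¹ two →
           (H :* P) :* (two :* (t :* G) :+ (two :* n⁻¹) :* (t :* ∂G) :- two :* G) :=
           (two :* t :- two) :* (H :* (P :* G)) :+ (two :* n⁻¹) :* ((H :* P) :* (t :* ∂G)))
           refl H P G ∂G t n⁻¹ two ⟩
    (two * t - two) * (H * (P * G)) + (two * n⁻¹) * ((H * P) * (t * ∂G))
      ≈⟨ +-cong (*-congˡ (*-congˡ PG≈T))
                (*-congˡ (derivative-term PG≈T ∂[PG]≈∂T H∂P≈n∂HP t∂T≈nT)) ⟩
    (two * t - two) * (H * T) + (two * n⁻¹) * (n * (H * T - t * (∂H * T)))
      ≈⟨ solve 7 (λ H ∂H T t n n⁻¹ two →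
           (two :* t :- two) :* (H :* T) :+ (two :* n⁻¹) :* (n :* (H :* T :- t :* (∂H :* T))) :=
           (two :* t :- two) :* (H :* T) :+ (two :* (n :* n⁻¹)) :* (H :* T :- t :* (∂H :* T)))
           refl H ∂H T t n n⁻¹ two ⟩
    (two * t - two) * (H * T) + (two * (n * n⁻¹)) * (H * T - t * (∂H * T))
      ≈⟨ +-congˡ (*-cong (*-congˡ nn⁻¹≈1) (+-congˡ (-‿cong (*-congˡ (*-congʳ ∂H≈H-1))))) ⟩
    (two * t - two) * (H * T) + (two * 1#) * (H * T - t * ((H - 1#) * T))
      ≈⟨ solve 4 (λ H T t two →
           (two :* t :- two) :* (H :* T) :+ (two :* con (+ 1)) :* (H :* T :- t :* ((H :- con (+ 1)) :* T)) :=
           two :* (t :* T))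
           refl H T t two ⟩
    two * (t * T)
      ≈⟨ 2tT≈T′ ⟩
    T′ ∎

module HurwitzSeries {c ℓ} (R : CommutativeRing c ℓ) where
  open CommutativeRing R
  open import Relation.Binary.Reasoning.Setoid setoid
  open import Algebra.Properties.CommutativeSemigroup +-commutativeSemigroup using (interchange)

  -- The series Σₖ aₖ tᵏ/k! is represented by its coefficient sequence a.
  Series : Set c
  Series = ℕ → Carrier

  -- Coefficientwise equality; a record so that both sides are inferable.
  infix 4 _≋_
  record _≋_ (a b : Series) : Set ℓ where
    constructor coefficientwise
    field coefficient : ∀ k → a k ≈ b k
  open _≋_ public

  -- d/dt shifts exponential coefficients.
  ∂ : Series → Series
  ∂ a k = a (suc k)

  ∂-cong : ∀ {a b} → a ≋ b → ∂ a ≋ ∂ b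
  ∂-cong a≋b = coefficientwise λ k → coefficient a≋b (suc k)

  infixl 6 _⊕_
  infixl 7 _⊛_

  _⊕_ : Series → Series → Series
  (a ⊕ b) k = a k + b k

  ⊝_ : Series → Series
  (⊝ a) k = - a k

  const : Carrier → Series
  const x zero    = x
  const x (suc k) = 0#

  𝟘 𝟙 : Series
  𝟘 k = 0#
  𝟙 = const 1#

  -- The product of exponential generating functions, characterised by its
  -- constant term and the Leibniz rule ∂ (a ⊛ b) = ∂ a ⊛ b + a ⊛ ∂ b.
  _⊛_ : Series → Series → Series
  (a ⊛ b) zero    = a 0 * b 0
  (a ⊛ b) (suc k) = (∂ a ⊛ b) k + (a ⊛ ∂ b) k

  private
    ⊛-cong : ∀ k {a a′ b b′} → a ≋ a′ → b ≋ b′ → (a ⊛ b) k ≈ (a′ ⊛ b′) k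
    ⊛-cong zero    a≋a′ b≋b′ = *-cong (coefficient a≋a′ 0) (coefficient b≋b′ 0)
    ⊛-cong (suc k) a≋a′ b≋b′ = +-cong
      (⊛-cong k (coefficientwise (λ j → coefficient a≋a′ (suc j))) b≋b′)
      (⊛-cong k a≋a′ (coefficientwise (λ j → coefficient b≋b′ (suc j))))

    ⊛-comm : ∀ k a b → (a ⊛ b) k ≈ (b ⊛ a) k
    ⊛-comm zero    a b = *-comm _ _
    ⊛-comm (suc k) a b = trans (+-cong (⊛-comm k (∂ a) b) (⊛-comm k a (∂ b))) (+-comm _ _)

    ⊛-distribˡ : ∀ k a b c → (a ⊛ (b ⊕ c)) k ≈ (a ⊛ b) k + (a ⊛ c) k
    ⊛-distribˡ zero    a b c = distribˡ _ _ _
    ⊛-distribˡ (suc k) a b c =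
      trans (+-cong (⊛-distribˡ k (∂ a) b c) (⊛-distribˡ k a (∂ b) (∂ c))) (interchange _ _ _ _)

    ⊛-distribʳ : ∀ k a b c → ((b ⊕ c) ⊛ a) k ≈ (b ⊛ a) k + (c ⊛ a) k
    ⊛-distribʳ k a b c = begin
      ((b ⊕ c) ⊛ a) k         ≈⟨ ⊛-comm k (b ⊕ c) a ⟩
      (a ⊛ (b ⊕ c)) k         ≈⟨ ⊛-distribˡ k a b c ⟩
      (a ⊛ b) k + (a ⊛ c) k   ≈⟨ +-cong (⊛-comm k a b) (⊛-comm k a c) ⟩
      (b ⊛ a) k + (c ⊛ a) k   ∎

    ⊛-assoc : ∀ k a b c → ((a ⊛ b) ⊛ c) k ≈ (a ⊛ (b ⊛ c)) k
    ⊛-assoc zero    a b c = *-assoc _ _ _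
    ⊛-assoc (suc k) a b c = begin
      ((∂ a ⊛ b ⊕ a ⊛ ∂ b) ⊛ c) k + ((a ⊛ b) ⊛ ∂ c) k
        ≈⟨ +-congʳ (⊛-distribʳ k c (∂ a ⊛ b) (a ⊛ ∂ b)) ⟩
      (((∂ a ⊛ b) ⊛ c) k + ((a ⊛ ∂ b) ⊛ c) k) + ((a ⊛ b) ⊛ ∂ c) k
        ≈⟨ +-cong (+-cong (⊛-assoc k (∂ a) b c) (⊛-assoc k a (∂ b) c)) (⊛-assoc k a b (∂ c)) ⟩
      ((∂ a ⊛ (b ⊛ c)) k + (a ⊛ (∂ b ⊛ c)) k) + (a ⊛ (b ⊛ ∂ c)) k
        ≈⟨ +-assoc _ _ _ ⟩
      (∂ a ⊛ (b ⊛ c)) k + ((a ⊛ (∂ b ⊛ c)) k + (a ⊛ (b ⊛ ∂ c)) k)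
        ≈⟨ +-congˡ (⊛-distribˡ k a (∂ b ⊛ c) (b ⊛ ∂ c)) ⟨
      (∂ a ⊛ (b ⊛ c)) k + (a ⊛ (∂ b ⊛ c ⊕ b ⊛ ∂ c)) k ∎

    ⊛-zeroˡ : ∀ k a → (𝟘 ⊛ a) k ≈ 0#
    ⊛-zeroˡ zero    a = zeroˡ _
    ⊛-zeroˡ (suc k) a = trans (+-cong (⊛-zeroˡ k a) (⊛-zeroˡ k (∂ a))) (+-identityˡ _)

  const-⊛ : ∀ x a k → (const x ⊛ a) k ≈ x * a k
  const-⊛ x a zero    = refl
  const-⊛ x a (suc k) = begin
    (∂ (const x) ⊛ a) k + (const x ⊛ ∂ a) k  ≈⟨ +-cong (⊛-zeroˡ k a) (const-⊛ x (∂ a) k) ⟩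
    0# + x * a (suc k)                       ≈⟨ +-identityˡ _ ⟩
    x * a (suc k)                            ∎

  private
    ⊛-identityˡ : ∀ k a → (𝟙 ⊛ a) k ≈ a k
    ⊛-identityˡ k a = trans (const-⊛ 1# a k) (*-identityˡ _)

    ≋-isEquivalence : IsEquivalence _≋_
    ≋-isEquivalence = record
      { refl  = coefficientwise (λ _ → refl)
      ; sym   = λ p → coefficientwise (λ k → sym (coefficient p k))
      ; trans = λ p q → coefficientwise (λ k → trans (coefficient p k) (coefficient q k))
      }

    series-isCommutativeRing : IsCommutativeRing _≋_ _⊕_ _⊛_ ⊝_ 𝟘 𝟙
    series-isCommutativeRing = record
      { isRing = record
        { +-isAbelianGroup = record
          { isGroup = record
            { isMonoid = record
              { isSemigroup = record
                { isMagma = record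
                  { isEquivalence = ≋-isEquivalence
                  ; ∙-cong = λ p q → coefficientwise λ k → +-cong (coefficient p k) (coefficient q k) }
                ; assoc = λ a b c → coefficientwise λ _ → +-assoc _ _ _ }
              ; identity = (λ a → coefficientwise λ _ → +-identityˡ _) , (λ a → coefficientwise λ _ → +-identityʳ _) }
            ; inverse = (λ a → coefficientwise λ _ → -‿inverseˡ _) , (λ a → coefficientwise λ _ → -‿inverseʳ _)
            ; ⁻¹-cong = λ p → coefficientwise λ k → -‿cong (coefficient p k) }
          ; comm = λ a b → coefficientwise λ _ → +-comm _ _ }
        ; *-cong = λ p q → coefficientwise λ k → ⊛-cong k p q
        ; *-assoc = λ a b c → coefficientwise λ k → ⊛-assoc k a b c
        ; *-identity = (λ a → coefficientwise λ k → ⊛-identityˡ k a)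
                     , (λ a → coefficientwise λ k → trans (⊛-comm k a 𝟙) (⊛-identityˡ k a))
        ; distrib = (λ a b c → coefficientwise λ k → ⊛-distribˡ k a b c)
                  , (λ a b c → coefficientwise λ k → ⊛-distribʳ k a b c) }
      ; *-comm = λ a b → coefficientwise λ k → ⊛-comm k a b }

  seriesRing : CommutativeRing c ℓ
  seriesRing = record { isCommutativeRing = series-isCommutativeRing }

  private
    module R-Facts = CommutativeRingFacts R
    module S-Facts = CommutativeRingFacts seriesRing

  const-cong : ∀ {x y} → x ≈ y → const x ≋ const y
  const-cong x≈y = coefficientwise λ where
    zero    → x≈y
    (suc k) → refl

  const-+ : ∀ x y → const (x + y) ≋ const x ⊕ const y
  const-+ x y = coefficientwise λ where
    zero    → refl
    (suc k) → sym (+-identityˡ 0#)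

  const-* : ∀ x y → const x ⊛ const y ≋ const (x * y)
  const-* x y = coefficientwise λ k → trans (const-⊛ x (const y) k) (coefficients k)
    where
    coefficients : ∀ k → x * const y k ≈ const (x * y) k
    coefficients zero    = refl
    coefficients (suc k) = zeroʳ x

  t : Series
  t 1 = 1#
  t _ = 0#

  t-⊛ : ∀ a k → (t ⊛ a) (suc k) ≈ natR R (suc k) * a k
  t-⊛ a zero = begin
    1# * a 0 + 0# * a 1    ≈⟨ +-congˡ (zeroˡ (a 1)) ⟩
    1# * a 0 + 0#          ≈⟨ +-identityʳ _ ⟩
    1# * a 0               ≈⟨ *-congʳ (+-identityʳ 1#) ⟨
    (1# + 0#) * a 0        ∎
  t-⊛ a (suc k) = begin
    (∂ t ⊛ a) (suc k) + (t ⊛ ∂ a) (suc k)  ≈⟨ +-cong (coefficient ∂t⊛a≋a (suc k)) (t-⊛ (∂ a) k) ⟩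
    a (suc k) + natR R (suc k) * a (suc k) ≈⟨ +-congʳ (*-identityˡ _) ⟨
    1# * a (suc k) + natR R (suc k) * a (suc k) ≈⟨ distribʳ _ _ _ ⟨
    (1# + natR R (suc k)) * a (suc k)      ∎
    where
    ∂t⊛a≋a : ∂ t ⊛ a ≋ a
    ∂t⊛a≋a = S.trans (S.*-congʳ (coefficientwise λ { zero → refl ; (suc k) → refl })) (S.*-identityˡ a)
      where module S = CommutativeRing seriesRing

  t-⊛-∂ : ∀ a k → (t ⊛ ∂ a) k ≈ natR R k * a k
  t-⊛-∂ a zero    = trans (zeroˡ _) (sym (zeroˡ _))
  t-⊛-∂ a (suc k) = t-⊛ (∂ a) k

  const-cancellable : ∀ {x} → R-Facts.Cancellable x → S-Facts.Cancellable (const x)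
  const-cancellable {x} cancellable-x y x⊛y≋𝟘 = coefficientwise λ k →
    cancellable-x (y k) (trans (sym (const-⊛ x y k)) (coefficient x⊛y≋𝟘 k))

  t-cancellable : (∀ m → R-Facts.Cancellable (natR R (suc m))) → S-Facts.Cancellable t
  t-cancellable cancellable-nat y t⊛y≋𝟘 = coefficientwise λ k →
    cancellable-nat k (y k) (trans (sym (t-⊛ y k)) (coefficient t⊛y≋𝟘 (suc k)))

module BinomialConvolution {c ℓ} (F : CharZeroField c ℓ) where
  open CharZeroField F
  open ApostolGenocchi F
  open HurwitzSeries commRing
  open IntegerCoefficients commRing using (natR-+)
  open import Relation.Binary.Reasoning.Setoid setoid
  open import Algebra.Properties.CommutativeSemigroup +-commutativeSemigroup using (interchange)

  private
    sum-cong : ∀ k {f g : ℕ → Carrier} → (∀ j → j ≤ k → f j ≈ g j) → sumUpTo f k ≈ sumUpTo g k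
    sum-cong zero    f≈g = f≈g 0 ℕ.z≤n
    sum-cong (suc k) f≈g = +-cong (sum-cong k (λ j j≤k → f≈g j (ℕ.m≤n⇒m≤1+n j≤k))) (f≈g (suc k) ℕ.≤-refl)

    sum-+ : ∀ k (f g : ℕ → Carrier) → sumUpTo (λ j → f j + g j) k ≈ sumUpTo f k + sumUpTo g k
    sum-+ zero    f g = refl
    sum-+ (suc k) f g = trans (+-congʳ (sum-+ k f g)) (interchange _ _ _ _)

    sum-peel : ∀ k (f : ℕ → Carrier) → sumUpTo f (suc k) ≈ f 0 + sumUpTo (λ j → f (suc j)) k
    sum-peel zero    f = refl
    sum-peel (suc k) f = trans (+-congʳ (sum-peel k f)) (+-assoc _ _ _)

  -- Pascal's rule gives the Leibniz recursion for the binomial convolution.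
  egfMul-suc : ∀ k a b → egfMul a b (suc k) ≈ egfMul (∂ a) b k + egfMul a (∂ b) k
  egfMul-suc k a b = begin
    sumUpTo g (suc k)                                     ≈⟨ sum-peel k g ⟩
    g 0 + sumUpTo (λ j → g (suc j)) k                     ≈⟨ +-congˡ (sum-cong k (λ j _ → pascal j)) ⟩
    g 0 + sumUpTo (λ j → A j + h (suc j)) k               ≈⟨ +-congˡ (sum-+ k A (λ j → h (suc j))) ⟩
    g 0 + (sumUpTo A k + sumUpTo (λ j → h (suc j)) k)     ≈⟨ +-assoc _ _ _ ⟨
    (g 0 + sumUpTo A k) + sumUpTo (λ j → h (suc j)) k     ≈⟨ +-congʳ (+-comm _ _) ⟩
    (sumUpTo A k + h 0) + sumUpTo (λ j → h (suc j)) k     ≈⟨ +-assoc _ _ _ ⟩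
    sumUpTo A k + (h 0 + sumUpTo (λ j → h (suc j)) k)     ≈⟨ +-congˡ (sum-peel k h) ⟨
    sumUpTo A k + (sumUpTo h k + h (suc k))               ≈⟨ +-congˡ (+-cong (sum-cong k h≈B) last-vanishes) ⟩
    sumUpTo A k + (sumUpTo B k + 0#)                      ≈⟨ +-congˡ (+-identityʳ _) ⟩
    sumUpTo A k + sumUpTo B k                             ∎
    where
    g h A B : ℕ → Carrier
    g j = nat (suc k C j) * (a j * b (suc k ∸ j))
    h j = nat (k C j) * (a j * b (suc k ∸ j))
    A j = nat (k C j) * (∂ a j * b (k ∸ j))
    B j = nat (k C j) * (a j * ∂ b (k ∸ j))

    pascal : ∀ j → g (suc j) ≈ A j + h (suc j)
    pascal j = begin
      nat (suc k C suc j) * (a (suc j) * b (k ∸ j))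
        ≡⟨ ≡.cong (λ z → nat z * (a (suc j) * b (k ∸ j))) (nCk+nC[k+1]≡[n+1]C[k+1] k j) ⟨
      nat (k C j ℕ.+ k C suc j) * (a (suc j) * b (k ∸ j))
        ≈⟨ *-congʳ (natR-+ (k C j) (k C suc j)) ⟩
      (nat (k C j) + nat (k C suc j)) * (a (suc j) * b (k ∸ j))
        ≈⟨ distribʳ _ _ _ ⟩
      A j + h (suc j) ∎

    h≈B : ∀ j → j ≤ k → h j ≈ B j
    h≈B j j≤k = reflexive (≡.cong (λ z → nat (k C j) * (a j * b z)) (ℕ.+-∸-assoc 1 j≤k))

    last-vanishes : h (suc k) ≈ 0#
    last-vanishes = begin
      nat (k C suc k) * (a (suc k) * b (k ∸ k))
        ≡⟨ ≡.cong (λ z → nat z * (a (suc k) * b (k ∸ k))) (k>n⇒nCk≡0 (ℕ.n<1+n k)) ⟩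
      0# * (a (suc k) * b (k ∸ k)) ≈⟨ zeroˡ _ ⟩
      0# ∎

  egfMul≋⊛ : ∀ a b → egfMul a b ≋ a ⊛ b
  egfMul≋⊛ a b = coefficientwise (λ k → go k a b)
    where
    go : ∀ k a b → egfMul a b k ≈ (a ⊛ b) k
    go zero    a b = trans (*-congʳ (+-identityʳ 1#)) (*-identityˡ _)
    go (suc k) a b = trans (egfMul-suc k a b) (+-cong (go k (∂ a) b) (go k a (∂ b)))

module ApostolGenocchiRecurrence {c ℓ} (F : CharZeroField c ℓ) (l : CharZeroField.Carrier F) where
  open CharZeroField F
  open ApostolGenocchi F
  open HurwitzSeries commRing
  open BinomialConvolution F using (egfMul≋⊛)
  open IntegerCoefficients commRing using (natR-*)
  module S = CommutativeRing seriesRing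
  module ≈-Reasoning = Relation.Binary.Reasoning.Setoid setoid
  module ≋-Reasoning = Relation.Binary.Reasoning.Setoid S.setoid
  module R-Facts = CommutativeRingFacts commRing
  module S-Facts = CommutativeRingFacts seriesRing

  H : Series
  H = lamExpPlusOne l

  P T : ℕ → Series
  P = egfPow H
  T = twoTPow

  P-zero : P 0 ≋ 𝟙
  P-zero = coefficientwise λ { zero → refl ; (suc k) → refl }

  P-suc : ∀ m → P (suc m) ≋ H ⊛ P m
  P-suc m = egfMul≋⊛ H (P m)

  -- d/dt (λeᵗ + 1) = λeᵗ = H - 1; in coefficients, λ = (λ + 1) - 1 and λ = λ - 0.
  ∂H≋H-1 : ∂ H ≋ H S.- 𝟙
  ∂H≋H-1 = coefficientwise coefficients
    where
    open import Algebra.Properties.Group +-group using (ε⁻¹≈ε)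
    coefficients : ∀ k → ∂ H k ≈ (H S.- 𝟙) k
    coefficients zero    = sym (trans (+-assoc l 1# (- 1#)) (trans (+-congˡ (-‿inverseʳ 1#)) (+-identityʳ l)))
    coefficients (suc k) = sym (trans (+-congˡ ε⁻¹≈ε) (+-identityʳ l))

  power-rule : ∀ m → H ⊛ ∂ (P m) ≋ const (nat m) ⊛ (∂ H ⊛ P m)
  power-rule zero = coefficientwise λ k →
    trans (coefficient (S.zeroʳ H) k) (sym (trans (const-⊛ 0# _ k) (zeroˡ _)))
  power-rule (suc m) = begin
    H ⊛ ∂ (P (suc m))                      ≈⟨ S.*-congˡ (∂-cong (P-suc m)) ⟩
    H ⊛ (∂ H ⊛ P m ⊕ H ⊛ ∂ (P m))          ≈⟨ S-Facts.power-rule-step (power-rule m) ⟩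
    (𝟙 ⊕ const (nat m)) ⊛ (∂ H ⊛ (H ⊛ P m)) ≈⟨ S.*-cong (S.sym (const-+ 1# (nat m))) (S.*-congˡ (S.sym (P-suc m))) ⟩
    const (nat (suc m)) ⊛ (∂ H ⊛ P (suc m)) ∎
    where open ≋-Reasoning

  private
    if-true : ∀ {b} {x y : Carrier} → IsTrue b → (if b then x else y) ≡.≡ x
    if-true {true} _ = ≡.refl

    if-false : ∀ {b} {x y : Carrier} → ¬ IsTrue b → (if b then x else y) ≡.≡ y
    if-false {false} _    = ≡.refl
    if-false {true}  ¬tt = ⊥-elim (¬tt tt)

  T-diagonal : ∀ n → T n n ≡.≡ nat (2 ^ n ℕ.* n !)
  T-diagonal n = if-true (ℕ.≡⇒≡ᵇ n n ≡.refl)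

  T-off-diagonal : ∀ n k → ¬ k ≡.≡ n → T n k ≡.≡ 0#
  T-off-diagonal n k k≢n = if-false (k≢n ∘ ℕ.≡ᵇ⇒≡ k n)

  euler-T : ∀ n → t ⊛ ∂ (T n) ≋ const (nat n) ⊛ T n
  euler-T n = coefficientwise λ k →
    trans (t-⊛-∂ (T n) k) (sym (trans (const-⊛ (nat n) (T n) k) (only-diagonal k (k ≟ n))))
    where
    only-diagonal : ∀ k → Dec (k ≡.≡ n) → nat n * T n k ≈ nat k * T n k
    only-diagonal k (yes ≡.refl) = refl
    only-diagonal k (no k≢n) rewrite T-off-diagonal n k k≢n = trans (zeroʳ _) (sym (zeroʳ _))

  two-t-T : ∀ n → const (nat 2) ⊛ (t ⊛ T n) ≋ T (suc n)
  two-t-T n = coefficientwise coefficients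
    where
    factorial-step : ∀ a s f → (2 ℕ.* a) ℕ.* (s ℕ.* f) ≡.≡ 2 ℕ.* (s ℕ.* (a ℕ.* f))
    factorial-step = solve-∀

    shifted : ∀ j → Dec (j ≡.≡ n) → nat 2 * (nat (suc j) * T n j) ≈ T (suc n) (suc j)
    shifted j (yes ≡.refl) rewrite T-diagonal j | T-diagonal (suc j) = begin
      nat 2 * (nat (suc j) * nat (2 ^ j ℕ.* j !))   ≈⟨ *-congˡ (natR-* (suc j) (2 ^ j ℕ.* j !)) ⟨
      nat 2 * nat (suc j ℕ.* (2 ^ j ℕ.* j !))       ≈⟨ natR-* 2 (suc j ℕ.* (2 ^ j ℕ.* j !)) ⟨
      nat (2 ℕ.* (suc j ℕ.* (2 ^ j ℕ.* j !)))       ≡⟨ ≡.cong nat (factorial-step (2 ^ j) (suc j) (j !)) ⟨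
      nat (2 ^ suc j ℕ.* suc j !)                   ∎
      where open ≈-Reasoning
    shifted j (no j≢n) rewrite T-off-diagonal n j j≢n | T-off-diagonal (suc n) (suc j) (j≢n ∘ ℕ.suc-injective) =
      trans (*-congˡ (zeroʳ _)) (zeroʳ _)

    coefficients : ∀ k → (const (nat 2) ⊛ (t ⊛ T n)) k ≈ T (suc n) k
    coefficients zero    = trans (*-congˡ (zeroˡ _)) (zeroʳ _)
    coefficients (suc j) = trans (const-⊛ (nat 2) (t ⊛ T n) (suc j)) (trans (*-congˡ (t-⊛ (T n) j)) (shifted j (j ≟ n)))

  T-one : T 1 ≋ const (nat 2) ⊛ t
  T-one = coefficientwise λ k → sym (trans (const-⊛ (nat 2) t k) (coefficients k))
    where
    coefficients : ∀ k → nat 2 * t k ≈ T 1 k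
    coefficients 0             = zeroʳ _
    coefficients 1             = *-identityʳ _
    coefficients (suc (suc k)) = zeroʳ _

  nat-cancellable : ∀ m → R-Facts.Cancellable (nat (suc m))
  nat-cancellable m = R-Facts.cancellable-unit (proj₂ (inverse (nat (suc m)) (charZero m)))

  two-t-cancellable : S-Facts.Cancellable (const (nat 2) ⊛ t)
  two-t-cancellable = S-Facts.cancellable-* (const-cancellable (nat-cancellable 1)) (t-cancellable nat-cancellable)

  module _ (G : ℕ → Series) (isAG : ∀ n → IsApostolGenocchi l n (G n)) where

    defining-equation : ∀ n → P n ⊛ G n ≋ T n
    defining-equation n = S.trans (S.sym (egfMul≋⊛ (P n) (G n))) (coefficientwise (isAG n))

    -- H is not a zero divisor, since H · G⁽¹⁾ = 2t is not.
    H-cancellable : S-Facts.Cancellable H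
    H-cancellable = S-Facts.cancellable-divisor H⊛G₁≋2t two-t-cancellable
      where
      open ≋-Reasoning
      H⊛G₁≋2t : H ⊛ G 1 ≋ const (nat 2) ⊛ t
      H⊛G₁≋2t = begin
        H ⊛ G 1          ≈⟨ S.*-congʳ (S.*-identityʳ H) ⟨
        (H ⊛ 𝟙) ⊛ G 1    ≈⟨ S.*-congʳ (S.*-congˡ P-zero) ⟨
        (H ⊛ P 0) ⊛ G 1  ≈⟨ S.*-congʳ (P-suc 0) ⟨
        P 1 ⊛ G 1        ≈⟨ defining-equation 1 ⟩
        T 1              ≈⟨ T-one ⟩
        const (nat 2) ⊛ t ∎

    P-cancellable : ∀ m → S-Facts.Cancellable (P m)
    P-cancellable zero    = S-Facts.cancellable-resp (S.sym P-zero) (S-Facts.cancellable-unit (S.*-identityʳ 𝟙))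
    P-cancellable (suc m) = S-Facts.cancellable-resp (S.sym (P-suc m)) (S-Facts.cancellable-* H-cancellable (P-cancellable m))

    recurrence-rhs : ℕ → Carrier → Series
    recurrence-rhs n invN =
      const (nat 2) ⊛ (t ⊛ G n) ⊕ (const (nat 2) ⊛ const invN) ⊛ (t ⊛ ∂ (G n)) S.- const (nat 2) ⊛ G n

    -- The recurrence as an identity of series: both sides times Hⁿ⁺¹ give (2t)ⁿ⁺¹.
    series-recurrence : ∀ n invN → nat n * invN ≈ 1# → G (suc n) ≋ recurrence-rhs n invN
    series-recurrence n invN n*invN≈1 = S-Facts.cancel (P-cancellable (suc n)) (begin
      P (suc n) ⊛ G (suc n)                 ≈⟨ defining-equation (suc n) ⟩
      T (suc n)                             ≈⟨ S-Facts.recurrence-identity (defining-equation n)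
                                                 (∂-cong (defining-equation n)) (power-rule n) (euler-T n)
                                                 ∂H≋H-1 n⁻¹-inverse (two-t-T n) ⟨
      (H ⊛ P n) ⊛ recurrence-rhs n invN     ≈⟨ S.*-congʳ (P-suc n) ⟨
      P (suc n) ⊛ recurrence-rhs n invN     ∎)
      where
      open ≋-Reasoning
      n⁻¹-inverse : const (nat n) ⊛ const invN ≋ 𝟙
      n⁻¹-inverse = S.trans (const-* (nat n) invN) (const-cong n*invN≈1)

    recurrence-rhs-coefficient : ∀ n invN j →
      recurrence-rhs n invN (suc j) ≈
        nat 2 * (nat (suc j) * G n j) + (nat 2 * invN) * (nat (suc j) * G n (suc j)) - nat 2 * G n (suc j)
    recurrence-rhs-coefficient n invN j = +-cong (+-cong two-t-G two-n⁻¹-t-∂G) (-‿cong two-G)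
      where
      open ≈-Reasoning
      two k : Carrier
      two = nat 2
      k = nat (suc j)
      two-t-G : (const two ⊛ (t ⊛ G n)) (suc j) ≈ two * (k * G n j)
      two-t-G = trans (const-⊛ two (t ⊛ G n) (suc j)) (*-congˡ (t-⊛ (G n) j))
      two-n⁻¹-t-∂G : ((const two ⊛ const invN) ⊛ (t ⊛ ∂ (G n))) (suc j) ≈ (two * invN) * (k * G n (suc j))
      two-n⁻¹-t-∂G = begin
        ((const two ⊛ const invN) ⊛ (t ⊛ ∂ (G n))) (suc j) ≈⟨ coefficient (S.*-congʳ (const-* two invN)) (suc j) ⟩
        (const (two * invN) ⊛ (t ⊛ ∂ (G n))) (suc j)       ≈⟨ const-⊛ (two * invN) (t ⊛ ∂ (G n)) (suc j) ⟩
        (two * invN) * (t ⊛ ∂ (G n)) (suc j)               ≈⟨ *-congˡ (t-⊛-∂ (G n) (suc j)) ⟩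
        (two * invN) * (k * G n (suc j))                   ∎
      two-G : (const two ⊛ G n) (suc j) ≈ two * G n (suc j)
      two-G = const-⊛ two (G n) (suc j)

    coefficient-recurrence : ∀ n invN → nat n * invN ≈ 1# → ∀ j →
      G (suc n) (suc j) ≈ nat (2 ℕ.* suc j) * G n j - (nat 2 - nat (2 ℕ.* suc j) * invN) * G n (suc j)
    coefficient-recurrence n invN n*invN≈1 j = begin
      G (suc n) (suc j)
        ≈⟨ coefficient (series-recurrence n invN n*invN≈1) (suc j) ⟩
      recurrence-rhs n invN (suc j)
        ≈⟨ recurrence-rhs-coefficient n invN j ⟩
      two * (k * G n j) + (two * invN) * (k * G n (suc j)) - two * G n (suc j)
        ≈⟨ solve 5 (λ two k invN g₀ g₁ →
             two :* (k :* g₀) :+ (two :* invN) :* (k :* g₁) :- two :* g₁ :=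
             (two :* k) :* g₀ :- (two :- (two :* k) :* invN) :* g₁)
             refl two k invN (G n j) (G n (suc j)) ⟩
      (two * k) * G n j - (two - (two * k) * invN) * G n (suc j)
        ≈⟨ +-cong (*-congʳ two-k) (-‿cong (*-congʳ (+-congˡ (-‿cong (*-congʳ two-k))))) ⟨
      nat (2 ℕ.* suc j) * G n j - (two - nat (2 ℕ.* suc j) * invN) * G n (suc j) ∎
      where
      open ≈-Reasoning
      open IntegerCoefficients commRing using (solve; _:+_; _:*_; _:-_; _:=_)
      two k : Carrier
      two = nat 2
      k = nat (suc j)
      two-k : nat (2 ℕ.* suc j) ≈ two * k
      two-k = natR-* 2 (suc j)

theorem2p15 : ∀ {c ℓ : Level} (F : CharZeroField c ℓ) →
    let open CharZeroField F in
    let open ApostolGenocchi F in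
    (l : Carrier) (G : ℕ → ℕ → Carrier) →
    (∀ n → IsApostolGenocchi l n (G n)) →
    (n k : ℕ) → 1 ≤ n → 1 ≤ k →
    (invN : Carrier) → nat n * invN ≈ 1# →
    G (suc n) k ≈ nat (2 *ℕ k) * G n (k ∸ 1) - (nat 2 - nat (2 *ℕ k) * invN) * G n k
theorem2p15 F l G isApostolGenocchi n (suc j) _ (s≤s z≤n) invN n*invN≈1 =
  ApostolGenocchiRecurrence.coefficient-recurrence F l G isApostolGenocchi n invN n*invN≈1 j
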